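{- In the setting described in the context, let $\rho_X\colon\Sigma(X+BX)\to TB\Sigma^{\star}X$ be a pre-De Simone law. Define for each $X\in\mathcal{C}$ $$\bar\rho_X=\mu_{B\Sigma^{\star}X}\circ T\rho_X\circ\delta^{\Sigma}_{X+BX}\circ\Sigma j_{X,BX}\circ\Sigma(\eta_X\times\mathrm{id}_{TBX})\colon\ \Sigma(X\times TBX)\to TB\Sigma^{\star}X.$$ Then $\bar\rho$ is a natural transformation (a GSOS law of $\Sigma$ over $TB$ in $\mathcal{C}$), and the operational model of $\bar\rho$ in $\mathcal{C}$, i.e. the unique $\gamma'\colon\mu\Sigma\to TB(\mu\Sigma)$ with $\gamma'\circ\iota=TB\hat\iota\circ\bar\rho_{\mu\Sigma}\circ\Sigma\langle\mathrm{id},\gamma'\rangle$, coincides with the operational model $\gamma$ of $\rho$ in $\mathrm{Kl}(T)$.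
   Context: Setting: $\mathcal{C}$ is a category with finite limits and finite coproducts; $\Sigma,B$ are endofunctors and $(T,\eta,\mu)$ a monad on $\mathcal{C}$; $\Sigma$ has an initial algebra $(\mu\Sigma,\iota)$ and free algebras $\Sigma^{\star}X$ (free monad $\Sigma^{\star}$), and $\hat\iota\colon\Sigma^{\star}(\mu\Sigma)\to\mu\Sigma$ is the unique $\Sigma$-algebra morphism extending $\mathrm{id}_{\mu\Sigma}$. The Kleisli category $\mathrm{Kl}(T)$ has as morphisms $X\rightsquigarrow Y$ the $\mathcal{C}$-morphisms $X\to TY$, composition $g\cdot f=\mu\circ Tg\circ f$, identities $\eta$; $J\colon\mathcal{C}\to\mathrm{Kl}(T)$, $Jf=\eta\circ f$. Assumptions: (1) there is a natural isomorphism $j_{X,Y}\colon TX\times TY\to T(X+Y)$; consequently in $\mathrm{Kl}(T)$ the product of $X,Y$ is carried by $X+Y$, with the pairing of $f\colon Z\to TX$, $g\colon Z\to TY$ being $j\circ\langle f,g\rangle$. (2) There are distributive laws $\delta^{\Sigma}\colon\Sigma T\to T\Sigma$ and $\delta^B\colon BT\to TB$ (natural transformations with $\delta\circ F\eta=\eta F$ and $\delta\circ F\mu=\mu F\circ T\delta\circ\delta T$), inducing Kleisli extensions $\bar\Sigma,\bar B$ of $\Sigma,B$ to $\mathrm{Kl}(T)$ (identity on objects, $\bar\Sigma f=\delta^{\Sigma}\circ\Sigma f$, $\bar Bf=\delta^B\circ Bf$). The free monad of $\bar\Sigma$ on $\mathrm{Kl}(T)$ is a Kleisli extension $\overline{\Sigma^{\star}}$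 of $\Sigma^{\star}$, corresponding to a distributive law $\delta^{\Sigma^{\star}}\colon\Sigma^{\star}T\to T\Sigma^{\star}$; the initial $\bar\Sigma$-algebra is $(\mu\Sigma,J\iota)$. (3) $B$ has an initial algebra $(\mu B,\beta)$; every hom-set of $\mathrm{Kl}(T)$ is a DCPO with least element $\bot$, Kleisli composition preserves directed joins in each argument and satisfies $\bot\cdot f=\bot$; $\bar B$ is locally monotone. A pre-De Simone law is a natural transformation $\rho_X\colon\Sigma(X+BX)\to TB\Sigma^{\star}X$; via (1) each $\rho_X$ is a Kleisli morphism $\bar\Sigma(X\times\bar BX)\rightsquigarrow\bar B\overline{\Sigma^{\star}}X$. Its operational model in $\mathrm{Kl}(T)$ is the unique $\gamma\colon\mu\Sigma\to TB(\mu\Sigma)$ with $\gamma\cdot J\iota=\bar BJ\hat\iota\cdot\rho_{\mu\Sigma}\cdot\bar\Sigma(j\circ\langle\eta,\gamma\rangle)$ in $\mathrm{Kl}(T)$. -}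

module Defs where

open import Level using (Level; _⊔_; suc)
open import Relation.Binary using (Rel; IsEquivalence; IsPartialOrder)
open import Data.Product using (Σ; _×_; ∃)

record Category (o ℓ e : Level) : Set (suc (o ⊔ ℓ ⊔ e)) where
  infixr 9 _∘_
  infix  4 _≈_
  field
    Obj   : Set o
    Hom   : Obj → Obj → Set ℓ
    _≈_   : ∀ {A B} → Rel (Hom A B) e
    id    : ∀ {A} → Hom A A
    _∘_   : ∀ {A B C} → Hom B C → Hom A B → Hom A C
    equiv : ∀ {A B} → IsEquivalence (_≈_ {A} {B})
    assoc : ∀ {A B C D} {f : Hom A B} {g : Hom B C} {h : Hom C D} →
            (h ∘ g) ∘ f ≈ h ∘ (g ∘ f)
    identityˡ : ∀ {A B} {f : Hom A B} → id ∘ f ≈ f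
    identityʳ : ∀ {A B} {f : Hom A B} → f ∘ id ≈ f
    ∘-resp-≈  : ∀ {A B C} {f h : Hom B C} {g i : Hom A B} →
                f ≈ h → g ≈ i → f ∘ g ≈ h ∘ i

record Endofunctor {o ℓ e} (C : Category o ℓ e) : Set (o ⊔ ℓ ⊔ e) where
  open Category C
  field
    F₀ : Obj → Obj
    F₁ : ∀ {A B} → Hom A B → Hom (F₀ A) (F₀ B)
    identity     : ∀ {A} → F₁ (id {A}) ≈ id
    homomorphism : ∀ {A B D} {f : Hom A B} {g : Hom B D} →
                   F₁ (g ∘ f) ≈ F₁ g ∘ F₁ f
    F-resp-≈     : ∀ {A B} {f g : Hom A B} → f ≈ g → F₁ f ≈ F₁ g

module _ {o ℓ e} (C : Category o ℓ e) where
  open Category C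

  record Terminal : Set (o ⊔ ℓ ⊔ e) where
    field
      ⊤  : Obj
      !  : ∀ {A} → Hom A ⊤
      !-unique : ∀ {A} (f : Hom A ⊤) → f ≈ !

  record BinaryProducts : Set (o ⊔ ℓ ⊔ e) where
    infixr 7 _×ₒ_
    field
      _×ₒ_  : Obj → Obj → Obj
      π₁    : ∀ {A B} → Hom (A ×ₒ B) A
      π₂    : ∀ {A B} → Hom (A ×ₒ B) B
      ⟨_,_⟩ : ∀ {A B X} → Hom X A → Hom X B → Hom X (A ×ₒ B)
      project₁ : ∀ {A B X} {f : Hom X A} {g : Hom X B} → π₁ ∘ ⟨ f , g ⟩ ≈ f
      project₂ : ∀ {A B X} {f : Hom X A} {g : Hom X B} → π₂ ∘ ⟨ f , g ⟩ ≈ g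
      ⟨⟩-unique : ∀ {A B X} {f : Hom X A} {g : Hom X B} {h : Hom X (A ×ₒ B)} →
                  π₁ ∘ h ≈ f → π₂ ∘ h ≈ g → h ≈ ⟨ f , g ⟩
    _⁂_ : ∀ {A B A' B'} → Hom A A' → Hom B B' → Hom (A ×ₒ B) (A' ×ₒ B')
    f ⁂ g = ⟨ f ∘ π₁ , g ∘ π₂ ⟩

  record Equalizers : Set (o ⊔ ℓ ⊔ e) where
    field
      Eq    : ∀ {A B} → Hom A B → Hom A B → Obj
      eqArr : ∀ {A B} {f g : Hom A B} → Hom (Eq f g) A
      equality : ∀ {A B} {f g : Hom A B} → f ∘ eqArr {f = f} {g} ≈ g ∘ eqArr
      equalize : ∀ {A B X} {f g : Hom A B} (h : Hom X A) → f ∘ h ≈ g ∘ h →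
                 Hom X (Eq f g)
      universal : ∀ {A B X} {f g : Hom A B} {h : Hom X A} {p : f ∘ h ≈ g ∘ h} →
                  eqArr ∘ equalize h p ≈ h
      eq-unique : ∀ {A B X} {f g : Hom A B} {h : Hom X A} {p : f ∘ h ≈ g ∘ h}
                  {i : Hom X (Eq f g)} → eqArr ∘ i ≈ h → i ≈ equalize h p

  record FiniteLimits : Set (o ⊔ ℓ ⊔ e) where
    field
      terminal   : Terminal
      products   : BinaryProducts
      equalizers : Equalizers

  record InitialObject : Set (o ⊔ ℓ ⊔ e) where
    field
      ⊥ₒ : Obj
      ¡  : ∀ {A} → Hom ⊥ₒ A
      ¡-unique : ∀ {A} (f : Hom ⊥ₒ A) → f ≈ ¡

  record BinaryCoproducts : Set (o ⊔ ℓ ⊔ e) where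
    infixr 6 _+ₒ_
    field
      _+ₒ_  : Obj → Obj → Obj
      i₁    : ∀ {A B} → Hom A (A +ₒ B)
      i₂    : ∀ {A B} → Hom B (A +ₒ B)
      [_,_] : ∀ {A B X} → Hom A X → Hom B X → Hom (A +ₒ B) X
      inject₁ : ∀ {A B X} {f : Hom A X} {g : Hom B X} → [ f , g ] ∘ i₁ ≈ f
      inject₂ : ∀ {A B X} {f : Hom A X} {g : Hom B X} → [ f , g ] ∘ i₂ ≈ g
      []-unique : ∀ {A B X} {f : Hom A X} {g : Hom B X} {h : Hom (A +ₒ B) X} →
                  h ∘ i₁ ≈ f → h ∘ i₂ ≈ g → h ≈ [ f , g ]
    _+₁_ : ∀ {A B A' B'} → Hom A A' → Hom B B' → Hom (A +ₒ B) (A' +ₒ B')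
    f +₁ g = [ i₁ ∘ f , i₂ ∘ g ]

  record FiniteCoproducts : Set (o ⊔ ℓ ⊔ e) where
    field
      initial    : InitialObject
      coproducts : BinaryCoproducts

module _ {o ℓ e} {C : Category o ℓ e} where
  open Category C

  record Monad : Set (o ⊔ ℓ ⊔ e) where
    field
      T : Endofunctor C
    open Endofunctor T public
    field
      η : ∀ X → Hom X (F₀ X)
      μ : ∀ X → Hom (F₀ (F₀ X)) (F₀ X)
      η-natural : ∀ {X Y} (f : Hom X Y) → η Y ∘ f ≈ F₁ f ∘ η X
      μ-natural : ∀ {X Y} (f : Hom X Y) → μ Y ∘ F₁ (F₁ f) ≈ F₁ f ∘ μ X
      assocᴹ    : ∀ {X} → μ X ∘ F₁ (μ X) ≈ μ X ∘ μ (F₀ X)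
      identityˡᴹ : ∀ {X} → μ X ∘ F₁ (η X) ≈ id
      identityʳᴹ : ∀ {X} → μ X ∘ η (F₀ X) ≈ id

  record InitialAlgebra (F : Endofunctor C) : Set (o ⊔ ℓ ⊔ e) where
    open Endofunctor F
    field
      carrier : Obj
      ι       : Hom (F₀ carrier) carrier
      fold    : ∀ {A} → Hom (F₀ A) A → Hom carrier A
      fold-alg : ∀ {A} {a : Hom (F₀ A) A} → fold a ∘ ι ≈ a ∘ F₁ (fold a)
      fold-unique : ∀ {A} {a : Hom (F₀ A) A} {h : Hom carrier A} →
                    h ∘ ι ≈ a ∘ F₁ h → h ≈ fold a

  record FreeAlgebras (F : Endofunctor C) : Set (o ⊔ ℓ ⊔ e) where
    open Endofunctor F
    field
      Free  : Obj → Obj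
      unit  : ∀ X → Hom X (Free X)
      alg   : ∀ X → Hom (F₀ (Free X)) (Free X)
      ext   : ∀ {X A} → Hom (F₀ A) A → Hom X A → Hom (Free X) A
      ext-unit : ∀ {X A} {a : Hom (F₀ A) A} {f : Hom X A} → ext a f ∘ unit X ≈ f
      ext-alg  : ∀ {X A} {a : Hom (F₀ A) A} {f : Hom X A} →
                 ext a f ∘ alg X ≈ a ∘ F₁ (ext a f)
      ext-unique : ∀ {X A} {a : Hom (F₀ A) A} {f : Hom X A} {h : Hom (Free X) A} →
                   h ∘ unit X ≈ f → h ∘ alg X ≈ a ∘ F₁ h → h ≈ ext a f
    Free₁ : ∀ {X Y} → Hom X Y → Hom (Free X) (Free Y)
    Free₁ {X} {Y} f = ext (alg Y) (unit Y ∘ f)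

  record DistributiveLaw (M : Monad) (F : Endofunctor C) : Set (o ⊔ ℓ ⊔ e) where
    private module M = Monad M
    private module F = Endofunctor F
    field
      δ : ∀ X → Hom (F.F₀ (M.F₀ X)) (M.F₀ (F.F₀ X))
      δ-natural : ∀ {X Y} (f : Hom X Y) →
                  δ Y ∘ F.F₁ (M.F₁ f) ≈ M.F₁ (F.F₁ f) ∘ δ X
      δ-η : ∀ {X} → δ X ∘ F.F₁ (M.η X) ≈ M.η (F.F₀ X)
      δ-μ : ∀ {X} → δ X ∘ F.F₁ (M.μ X) ≈ M.μ (F.F₀ X) ∘ M.F₁ (δ X) ∘ δ (M.F₀ X)

module Setting {o ℓ e} (C : Category o ℓ e)
                (FL : FiniteLimits C) (FC : FiniteCoproducts C)
                (M : Monad {C = C}) where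
  open Category C
  open BinaryProducts (FiniteLimits.products FL)
  open BinaryCoproducts (FiniteCoproducts.coproducts FC)
  open Monad M

  _⇝_ : Obj → Obj → Set ℓ
  X ⇝ Y = Hom X (F₀ Y)

  infixr 9 _·_
  _·_ : ∀ {X Y Z} → Y ⇝ Z → X ⇝ Y → X ⇝ Z
  _·_ {Z = Z} g f = μ Z ∘ F₁ g ∘ f

  Jₖ : ∀ {X Y} → Hom X Y → X ⇝ Y
  Jₖ {Y = Y} f = η Y ∘ f

  record ProductIso : Set (o ⊔ ℓ ⊔ e) where
    field
      j    : ∀ X Y → Hom (F₀ X ×ₒ F₀ Y) (F₀ (X +ₒ Y))
      j⁻¹  : ∀ X Y → Hom (F₀ (X +ₒ Y)) (F₀ X ×ₒ F₀ Y)
      j-iso₁ : ∀ {X Y} → j⁻¹ X Y ∘ j X Y ≈ id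
      j-iso₂ : ∀ {X Y} → j X Y ∘ j⁻¹ X Y ≈ id
      j-natural : ∀ {X Y X' Y'} (f : Hom X X') (g : Hom Y Y') →
                  j X' Y' ∘ (F₁ f ⁂ F₁ g) ≈ F₁ (f +₁ g) ∘ j X Y

  -- Kleisli extension of an endofunctor induced by a distributive law
  module _ {F : Endofunctor C} (δ : DistributiveLaw M F) where
    open Endofunctor F renaming (F₀ to G₀; F₁ to G₁)
    open DistributiveLaw δ renaming (δ to δ₀)
    ext₁ : ∀ {X Y} → X ⇝ Y → G₀ X ⇝ G₀ Y
    ext₁ {Y = Y} f = δ₀ Y ∘ G₁ f

  module _ (p i : Level) where
    record KleisliDCPO (B : Endofunctor C) (δB : DistributiveLaw M B)
           : Set (o ⊔ ℓ ⊔ e ⊔ suc p ⊔ suc i) where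
      field
        _⊑_ : ∀ {X Y} → Rel (X ⇝ Y) p
        isPartialOrder : ∀ {X Y} → IsPartialOrder (_≈_ {X} {F₀ Y}) _⊑_
        ⊥ₖ  : ∀ {X Y} → X ⇝ Y
        ⊥-least : ∀ {X Y} (f : X ⇝ Y) → ⊥ₖ ⊑ f

      Directed : ∀ {X Y} {I : Set i} → (I → X ⇝ Y) → Set (i ⊔ p)
      Directed {I = I} f = I × (∀ a b → ∃ λ c → (f a ⊑ f c) × (f b ⊑ f c))

      IsLub : ∀ {X Y} {I : Set i} → (I → X ⇝ Y) → X ⇝ Y → Set (i ⊔ p ⊔ ℓ)
      IsLub {X} {Y} f x = (∀ a → f a ⊑ x) × (∀ (y : X ⇝ Y) → (∀ a → f a ⊑ y) → x ⊑ y)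

      field
        ⋁ : ∀ {X Y} {I : Set i} (f : I → X ⇝ Y) → Directed f → X ⇝ Y
        ⋁-lub : ∀ {X Y} {I : Set i} (f : I → X ⇝ Y) (d : Directed f) → IsLub f (⋁ f d)
        ·-preserves-⋁ˡ : ∀ {X Y Z} {I : Set i} (g : Y ⇝ Z) (f : I → X ⇝ Y)
                         (d : Directed f) → IsLub (λ a → g · f a) (g · ⋁ f d)
        ·-preserves-⋁ʳ : ∀ {X Y Z} {I : Set i} (f : I → Y ⇝ Z) (d : Directed f)
                         (g : X ⇝ Y) → IsLub (λ a → f a · g) (⋁ f d · g)
        ⊥-· : ∀ {X Y Z} (f : X ⇝ Y) → _≈_ (⊥ₖ {Y} {Z} · f) ⊥ₖ
        B-locally-monotone : ∀ {X Y} {f g : X ⇝ Y} → f ⊑ g → ext₁ δB f ⊑ ext₁ δB g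

module DeSimone {o ℓ e} (C : Category o ℓ e)
                (FL : FiniteLimits C) (FC : FiniteCoproducts C)
                (M : Monad {C = C})
                (Sg B : Endofunctor C)
                (initΣ : InitialAlgebra Sg) (freeΣ : FreeAlgebras Sg)
                (PI : Setting.ProductIso C FL FC M)
                (δΣ : DistributiveLaw M Sg) (δB : DistributiveLaw M B) where
  open Category C
  open BinaryProducts (FiniteLimits.products FL)
  open BinaryCoproducts (FiniteCoproducts.coproducts FC)
  open Monad M
  open Setting C FL FC M
  open ProductIso PI
  private
    module S = Endofunctor Sg
    module B = Endofunctor B
    module Fr = FreeAlgebras freeΣ
    module I = InitialAlgebra initΣ
    module δΣ = DistributiveLaw δΣ

  μΣ : Obj
  μΣ = I.carrier

  ι : Hom (S.F₀ μΣ) μΣ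
  ι = I.ι

  ι̂ : Hom (Fr.Free μΣ) μΣ
  ι̂ = Fr.ext ι id

  record PreDeSimoneLaw : Set (o ⊔ ℓ ⊔ e) where
    field
      ρ : ∀ X → Hom (S.F₀ (X +ₒ B.F₀ X)) (F₀ (B.F₀ (Fr.Free X)))
      ρ-natural : ∀ {X Y} (f : Hom X Y) →
                  ρ Y ∘ S.F₁ (f +₁ B.F₁ f) ≈ F₁ (B.F₁ (Fr.Free₁ f)) ∘ ρ X

  module _ (L : PreDeSimoneLaw) where
    open PreDeSimoneLaw L

    ρ̄ : ∀ X → Hom (S.F₀ (X ×ₒ F₀ (B.F₀ X))) (F₀ (B.F₀ (Fr.Free X)))
    ρ̄ X = μ (B.F₀ (Fr.Free X)) ∘ F₁ (ρ X) ∘ δΣ.δ (X +ₒ B.F₀ X)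
          ∘ S.F₁ (j X (B.F₀ X)) ∘ S.F₁ (η X ⁂ id)

    ρ̄-IsNatural : Set (o ⊔ ℓ ⊔ e)
    ρ̄-IsNatural = ∀ {X Y} (f : Hom X Y) →
      ρ̄ Y ∘ S.F₁ (f ⁂ F₁ (B.F₁ f)) ≈ F₁ (B.F₁ (Fr.Free₁ f)) ∘ ρ̄ X

    IsKleisliOpModel : Hom μΣ (F₀ (B.F₀ μΣ)) → Set e
    IsKleisliOpModel γ =
      γ · Jₖ ι ≈ ext₁ δB (Jₖ ι̂) · (ρ μΣ · ext₁ δΣ (j μΣ (B.F₀ μΣ) ∘ ⟨ η μΣ , γ ⟩))

    IsOpModel : Hom μΣ (F₀ (B.F₀ μΣ)) → Set e
    IsOpModel γ' = γ' ∘ ι ≈ F₁ (B.F₁ ι̂) ∘ ρ̄ μΣ ∘ S.F₁ ⟨ id , γ' ⟩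

{-# OPTIONS --safe #-}
-- In Kl(T), ρ̄ is ρ precomposed with Σ̄ of the natural map jη = j ∘ (η × id), so ρ̄ is natural as
-- a composite of natural transformations, and the Kleisli equation of γ turns into the equation
-- of ρ̄ because g · Jf = g ∘ f and B̄(Jf) = J(Bf). Uniqueness holds because the equation of ρ̄ is
-- a paramorphism equation γ ∘ ι = h ∘ Σ⟨id, γ⟩: for any solution, ⟨id, γ⟩ is the fold of the
-- algebra ⟨ι ∘ Σπ₁, h⟩.
module Submission where

open import Defs
open import Level using (Level)
open import Data.Product using (_×_; _,_)
open import Relation.Binary using (IsEquivalence; Setoid)
import Relation.Binary.Reasoning.Setoid as SetoidReasoning

module CategoryReasoning {o ℓ e} (C : Category o ℓ e) where
  open Category C

  hom-setoid : Obj → Obj → Setoid ℓ e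
  hom-setoid A B = record { isEquivalence = equiv {A} {B} }

  open module HomEquivalence {A B : Obj} = IsEquivalence (equiv {A} {B}) public
    using (refl; sym; trans)
  open module HomReasoning {A B : Obj} = SetoidReasoning (hom-setoid A B) public

  infixr 4 _⟩∘⟨_ refl⟩∘⟨_
  infixl 5 _⟩∘⟨refl

  _⟩∘⟨_ : ∀ {A B D} {f h : Hom B D} {g k : Hom A B} → f ≈ h → g ≈ k → f ∘ g ≈ h ∘ k
  _⟩∘⟨_ = ∘-resp-≈

  refl⟩∘⟨_ : ∀ {A B D} {f : Hom B D} {g k : Hom A B} → g ≈ k → f ∘ g ≈ f ∘ k
  refl⟩∘⟨ p = refl ⟩∘⟨ p

  _⟩∘⟨refl : ∀ {A B D} {f h : Hom B D} {g : Hom A B} → f ≈ h → f ∘ g ≈ h ∘ g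
  p ⟩∘⟨refl = p ⟩∘⟨ refl

  module _ {A B D E} {a : Hom D E} {b : Hom B D} {f : Hom A B} where
    pullˡ : ∀ {c : Hom B E} → a ∘ b ≈ c → a ∘ b ∘ f ≈ c ∘ f
    pullˡ p = trans (sym assoc) (p ⟩∘⟨refl)

    extendʳ : ∀ {W} {c : Hom W E} {d : Hom B W} → a ∘ b ≈ c ∘ d → a ∘ b ∘ f ≈ c ∘ d ∘ f
    extendʳ p = trans (pullˡ p) assoc

  cancelˡ : ∀ {A B D} {a : Hom B D} {b : Hom D B} {f : Hom A D} → a ∘ b ≈ id → a ∘ b ∘ f ≈ f
  cancelˡ p = trans (pullˡ p) identityˡ

module ProductLemmas {o ℓ e} {C : Category o ℓ e} (P : BinaryProducts C) where
  open Category C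
  open BinaryProducts P
  open CategoryReasoning C

  ⟨⟩-cong₂ : ∀ {A B X} {f f′ : Hom X A} {g g′ : Hom X B} →
             f ≈ f′ → g ≈ g′ → ⟨ f , g ⟩ ≈ ⟨ f′ , g′ ⟩
  ⟨⟩-cong₂ p q = ⟨⟩-unique (trans project₁ p) (trans project₂ q)

  ⟨⟩∘ : ∀ {A B X Y} {f : Hom X A} {g : Hom X B} {h : Hom Y X} →
        ⟨ f , g ⟩ ∘ h ≈ ⟨ f ∘ h , g ∘ h ⟩
  ⟨⟩∘ = ⟨⟩-unique (pullˡ project₁) (pullˡ project₂)

  ⁂∘⟨⟩ : ∀ {A B A′ B′ X} {f : Hom A A′} {g : Hom B B′} {h : Hom X A} {k : Hom X B} →
         (f ⁂ g) ∘ ⟨ h , k ⟩ ≈ ⟨ f ∘ h , g ∘ k ⟩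
  ⁂∘⟨⟩ = trans ⟨⟩∘ (⟨⟩-cong₂ (trans assoc (refl⟩∘⟨ project₁)) (trans assoc (refl⟩∘⟨ project₂)))

  ⁂∘⁂ : ∀ {A B A′ B′ A″ B″} {f : Hom A′ A″} {g : Hom B′ B″} {h : Hom A A′} {k : Hom B B′} →
        (f ⁂ g) ∘ (h ⁂ k) ≈ (f ∘ h) ⁂ (g ∘ k)
  ⁂∘⁂ = trans ⁂∘⟨⟩ (⟨⟩-cong₂ (sym assoc) (sym assoc))

  ⁂-cong₂ : ∀ {A B A′ B′} {f f′ : Hom A A′} {g g′ : Hom B B′} →
            f ≈ f′ → g ≈ g′ → f ⁂ g ≈ f′ ⁂ g′
  ⁂-cong₂ p q = ⟨⟩-cong₂ (p ⟩∘⟨refl) (q ⟩∘⟨refl)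

module Paramorphism {o ℓ e} {C : Category o ℓ e} (P : BinaryProducts C)
                    {F : Endofunctor C} (I : InitialAlgebra F) where
  open Category C
  open BinaryProducts P
  open Endofunctor F
  open InitialAlgebra I
  open CategoryReasoning C
  open ProductLemmas P

  ⟨id,γ⟩≈fold : ∀ {A} {h : Hom (F₀ (carrier ×ₒ A)) A} {γ : Hom carrier A} →
                γ ∘ ι ≈ h ∘ F₁ ⟨ id , γ ⟩ → ⟨ id , γ ⟩ ≈ fold ⟨ ι ∘ F₁ π₁ , h ⟩
  ⟨id,γ⟩≈fold {h = h} {γ} para = fold-unique (begin
      ⟨ id , γ ⟩ ∘ ι                                        ≈⟨ ⟨⟩∘ ⟩
      ⟨ id ∘ ι , γ ∘ ι ⟩                                    ≈⟨ ⟨⟩-cong₂ first-component para ⟩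
      ⟨ (ι ∘ F₁ π₁) ∘ F₁ ⟨ id , γ ⟩ , h ∘ F₁ ⟨ id , γ ⟩ ⟩   ≈⟨ ⟨⟩∘ ⟨
      ⟨ ι ∘ F₁ π₁ , h ⟩ ∘ F₁ ⟨ id , γ ⟩                     ∎)
    where
    first-component : id ∘ ι ≈ (ι ∘ F₁ π₁) ∘ F₁ ⟨ id , γ ⟩
    first-component = begin
      id ∘ ι                        ≈⟨ identityˡ ⟩
      ι                             ≈⟨ identityʳ ⟨
      ι ∘ id                        ≈⟨ refl⟩∘⟨ identity ⟨
      ι ∘ F₁ id                     ≈⟨ refl⟩∘⟨ F-resp-≈ project₁ ⟨
      ι ∘ F₁ (π₁ ∘ ⟨ id , γ ⟩)      ≈⟨ refl⟩∘⟨ homomorphism ⟩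
      ι ∘ F₁ π₁ ∘ F₁ ⟨ id , γ ⟩     ≈⟨ assoc ⟨
      (ι ∘ F₁ π₁) ∘ F₁ ⟨ id , γ ⟩   ∎

  para-unique : ∀ {A} {h : Hom (F₀ (carrier ×ₒ A)) A} {γ γ′ : Hom carrier A} →
                γ ∘ ι ≈ h ∘ F₁ ⟨ id , γ ⟩ → γ′ ∘ ι ≈ h ∘ F₁ ⟨ id , γ′ ⟩ → γ ≈ γ′
  para-unique {γ = γ} {γ′} para para′ = begin
    γ                  ≈⟨ project₂ ⟨
    π₂ ∘ ⟨ id , γ ⟩    ≈⟨ refl⟩∘⟨ trans (⟨id,γ⟩≈fold para) (sym (⟨id,γ⟩≈fold para′)) ⟩
    π₂ ∘ ⟨ id , γ′ ⟩   ≈⟨ project₂ ⟩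
    γ′                 ∎

module KleisliLemmas {o ℓ e} (C : Category o ℓ e)
                     (FL : FiniteLimits C) (FC : FiniteCoproducts C) (M : Monad {C = C}) where
  open Category C
  open BinaryProducts (FiniteLimits.products FL)
  open BinaryCoproducts (FiniteCoproducts.coproducts FC)
  open Monad M
  open Setting C FL FC M
  open CategoryReasoning C
  open ProductLemmas (FiniteLimits.products FL)

  ·-resp-≈ˡ : ∀ {X Y Z} {g g′ : Y ⇝ Z} {f : X ⇝ Y} → g ≈ g′ → g · f ≈ g′ · f
  ·-resp-≈ˡ p = refl⟩∘⟨ F-resp-≈ p ⟩∘⟨refl

  ·-resp-≈ʳ : ∀ {X Y Z} {g : Y ⇝ Z} {f f′ : X ⇝ Y} → f ≈ f′ → g · f ≈ g · f′
  ·-resp-≈ʳ p = refl⟩∘⟨ refl⟩∘⟨ p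

  ·-∘ : ∀ {W X Y Z} {g : Y ⇝ Z} {f : X ⇝ Y} {h : Hom W X} → (g · f) ∘ h ≈ g · (f ∘ h)
  ·-∘ = trans assoc (refl⟩∘⟨ assoc)

  ·-Jₖ : ∀ {W X Y} {g : X ⇝ Y} {f : Hom W X} → g · Jₖ f ≈ g ∘ f
  ·-Jₖ {g = g} {f} = begin
    μ _ ∘ F₁ g ∘ η _ ∘ f   ≈⟨ refl⟩∘⟨ extendʳ (η-natural g) ⟨
    μ _ ∘ η _ ∘ g ∘ f      ≈⟨ cancelˡ identityʳᴹ ⟩
    g ∘ f                  ∎

  Jₖ-· : ∀ {X Y Z} {h : Hom Y Z} {f : X ⇝ Y} → Jₖ h · f ≈ F₁ h ∘ f
  Jₖ-· {h = h} {f} = begin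
    μ _ ∘ F₁ (η _ ∘ h) ∘ f        ≈⟨ refl⟩∘⟨ homomorphism ⟩∘⟨refl ⟩
    μ _ ∘ (F₁ (η _) ∘ F₁ h) ∘ f   ≈⟨ refl⟩∘⟨ assoc ⟩
    μ _ ∘ F₁ (η _) ∘ F₁ h ∘ f     ≈⟨ cancelˡ identityˡᴹ ⟩
    F₁ h ∘ f                      ∎

  ·-F₁∘ : ∀ {W X Y Z} {g : Y ⇝ Z} {h : Hom X Y} {f : W ⇝ X} → g · (F₁ h ∘ f) ≈ (g ∘ h) · f
  ·-F₁∘ = refl⟩∘⟨ pullˡ (sym homomorphism)

  F₁∘-· : ∀ {W X Y Z} {h : Hom Y Z} {g : X ⇝ Y} {f : W ⇝ X} → (F₁ h ∘ g) · f ≈ F₁ h ∘ (g · f)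
  F₁∘-· {h = h} {g} {f} = begin
    μ _ ∘ F₁ (F₁ h ∘ g) ∘ f        ≈⟨ refl⟩∘⟨ homomorphism ⟩∘⟨refl ⟩
    μ _ ∘ (F₁ (F₁ h) ∘ F₁ g) ∘ f   ≈⟨ refl⟩∘⟨ assoc ⟩
    μ _ ∘ F₁ (F₁ h) ∘ F₁ g ∘ f     ≈⟨ extendʳ (μ-natural h) ⟩
    F₁ h ∘ μ _ ∘ F₁ g ∘ f          ∎

  module _ {G : Endofunctor C} (δ : DistributiveLaw M G) where
    open Endofunctor G using ()
      renaming (F₁ to G₁; homomorphism to G-homomorphism; F-resp-≈ to G-resp-≈)
    open DistributiveLaw δ using (δ-natural; δ-η)

    ext₁-resp-≈ : ∀ {X Y} {f f′ : X ⇝ Y} → f ≈ f′ → ext₁ δ f ≈ ext₁ δ f′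
    ext₁-resp-≈ p = refl⟩∘⟨ G-resp-≈ p

    ext₁-∘ : ∀ {W X Y} {f : X ⇝ Y} {g : Hom W X} → ext₁ δ (f ∘ g) ≈ ext₁ δ f ∘ G₁ g
    ext₁-∘ = trans (refl⟩∘⟨ G-homomorphism) (sym assoc)

    ext₁-F₁∘ : ∀ {W X Y} {h : Hom X Y} {f : W ⇝ X} → ext₁ δ (F₁ h ∘ f) ≈ F₁ (G₁ h) ∘ ext₁ δ f
    ext₁-F₁∘ {h = h} = trans (refl⟩∘⟨ G-homomorphism) (extendʳ (δ-natural h))

    ext₁-Jₖ : ∀ {X Y} {f : Hom X Y} → ext₁ δ (Jₖ f) ≈ Jₖ (G₁ f)
    ext₁-Jₖ = trans (refl⟩∘⟨ G-homomorphism) (pullˡ δ-η)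

  module ProductIsoLemmas (PI : ProductIso) where
    open ProductIso PI

    jη : ∀ X Y → Hom (X ×ₒ F₀ Y) (F₀ (X +ₒ Y))
    jη X Y = j X Y ∘ (η X ⁂ id)

    jη-natural : ∀ {X Y X′ Y′} (f : Hom X X′) (g : Hom Y Y′) →
                 jη X′ Y′ ∘ (f ⁂ F₁ g) ≈ F₁ (f +₁ g) ∘ jη X Y
    jη-natural f g = begin
      (j _ _ ∘ (η _ ⁂ id)) ∘ (f ⁂ F₁ g)      ≈⟨ assoc ⟩
      j _ _ ∘ (η _ ⁂ id) ∘ (f ⁂ F₁ g)        ≈⟨ refl⟩∘⟨ ⁂∘⁂ ⟩
      j _ _ ∘ ((η _ ∘ f) ⁂ (id ∘ F₁ g))
        ≈⟨ refl⟩∘⟨ ⁂-cong₂ (η-natural f) (trans identityˡ (sym identityʳ)) ⟩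
      j _ _ ∘ ((F₁ f ∘ η _) ⁂ (F₁ g ∘ id))   ≈⟨ refl⟩∘⟨ ⁂∘⁂ ⟨
      j _ _ ∘ (F₁ f ⁂ F₁ g) ∘ (η _ ⁂ id)     ≈⟨ extendʳ (j-natural f g) ⟩
      F₁ (f +₁ g) ∘ j _ _ ∘ (η _ ⁂ id)       ∎

    jη∘⟨id,g⟩ : ∀ {X Y} {g : Hom X (F₀ Y)} → jη X Y ∘ ⟨ id , g ⟩ ≈ j X Y ∘ ⟨ η X , g ⟩
    jη∘⟨id,g⟩ = trans assoc (refl⟩∘⟨ trans ⁂∘⟨⟩ (⟨⟩-cong₂ identityʳ identityˡ))

module PreDeSimoneLaws {o ℓ e} (C : Category o ℓ e)
    (FL : FiniteLimits C) (FC : FiniteCoproducts C) (M : Monad {C = C})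
    (Sg B : Endofunctor C) (initΣ : InitialAlgebra Sg) (freeΣ : FreeAlgebras Sg)
    (PI : Setting.ProductIso C FL FC M)
    (δΣ : DistributiveLaw M Sg) (δB : DistributiveLaw M B)
    (L : DeSimone.PreDeSimoneLaw C FL FC M Sg B initΣ freeΣ PI δΣ δB) where
  open Category C
  open BinaryProducts (FiniteLimits.products FL)
  open BinaryCoproducts (FiniteCoproducts.coproducts FC)
  open Monad M
  open Setting C FL FC M
  open ProductIso PI
  open DeSimone C FL FC M Sg B initΣ freeΣ PI δΣ δB
  open PreDeSimoneLaw L
  open CategoryReasoning C
  open KleisliLemmas C FL FC M
  open ProductIsoLemmas PI
  open Paramorphism (FiniteLimits.products FL) initΣ
  private
    module S = Endofunctor Sg
    module B = Endofunctor B
    module Fr = FreeAlgebras freeΣ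

  ρ̄≈ρ·Σ̄jη : ∀ X → ρ̄ L X ≈ ρ X · ext₁ δΣ (jη X (B.F₀ X))
  ρ̄≈ρ·Σ̄jη X = refl⟩∘⟨ refl⟩∘⟨ refl⟩∘⟨ sym S.homomorphism

  ρ̄-natural : ρ̄-IsNatural L
  ρ̄-natural {X} {Y} f = begin
    ρ̄ L Y ∘ S.F₁ (f ⁂ F₁ (B.F₁ f))                      ≈⟨ ρ̄≈ρ·Σ̄jη Y ⟩∘⟨refl ⟩
    (ρ Y · ext₁ δΣ (jη Y _)) ∘ S.F₁ (f ⁂ F₁ (B.F₁ f))   ≈⟨ ·-∘ ⟩
    ρ Y · ext₁ δΣ (jη Y _) ∘ S.F₁ (f ⁂ F₁ (B.F₁ f))     ≈⟨ ·-resp-≈ʳ (ext₁-∘ δΣ) ⟨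
    ρ Y · ext₁ δΣ (jη Y _ ∘ (f ⁂ F₁ (B.F₁ f)))          ≈⟨ ·-resp-≈ʳ (ext₁-resp-≈ δΣ (jη-natural _ _)) ⟩
    ρ Y · ext₁ δΣ (F₁ (f +₁ B.F₁ f) ∘ jη X _)           ≈⟨ ·-resp-≈ʳ (ext₁-F₁∘ δΣ) ⟩
    ρ Y · F₁ (S.F₁ (f +₁ B.F₁ f)) ∘ ext₁ δΣ (jη X _)    ≈⟨ ·-F₁∘ ⟩
    (ρ Y ∘ S.F₁ (f +₁ B.F₁ f)) · ext₁ δΣ (jη X _)       ≈⟨ ·-resp-≈ˡ (ρ-natural f) ⟩
    (F₁ (B.F₁ (Fr.Free₁ f)) ∘ ρ X) · ext₁ δΣ (jη X _)   ≈⟨ F₁∘-· ⟩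
    F₁ (B.F₁ (Fr.Free₁ f)) ∘ ρ X · ext₁ δΣ (jη X _)     ≈⟨ refl⟩∘⟨ ρ̄≈ρ·Σ̄jη X ⟨
    F₁ (B.F₁ (Fr.Free₁ f)) ∘ ρ̄ L X                      ∎

  ρ·Σ̄j⟨η,g⟩≈ρ̄∘Σ⟨id,g⟩ : ∀ {X} (g : Hom X (F₀ (B.F₀ X))) →
                         ρ X · ext₁ δΣ (j X _ ∘ ⟨ η X , g ⟩) ≈ ρ̄ L X ∘ S.F₁ ⟨ id , g ⟩
  ρ·Σ̄j⟨η,g⟩≈ρ̄∘Σ⟨id,g⟩ {X} g = begin
    ρ X · ext₁ δΣ (j X _ ∘ ⟨ η X , g ⟩)          ≈⟨ ·-resp-≈ʳ (ext₁-resp-≈ δΣ (jη∘⟨id,g⟩)) ⟨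
    ρ X · ext₁ δΣ (jη X _ ∘ ⟨ id , g ⟩)          ≈⟨ ·-resp-≈ʳ (ext₁-∘ δΣ) ⟩
    ρ X · ext₁ δΣ (jη X _) ∘ S.F₁ ⟨ id , g ⟩     ≈⟨ ·-∘ ⟨
    (ρ X · ext₁ δΣ (jη X _)) ∘ S.F₁ ⟨ id , g ⟩   ≈⟨ ρ̄≈ρ·Σ̄jη X ⟩∘⟨refl ⟨
    ρ̄ L X ∘ S.F₁ ⟨ id , g ⟩                      ∎

  kleisliOpModel⇒opModel : ∀ {γ} → IsKleisliOpModel L γ → IsOpModel L γ
  kleisliOpModel⇒opModel {γ} kleisli = begin
    γ ∘ ι                                                     ≈⟨ ·-Jₖ ⟨
    γ · Jₖ ι                                                  ≈⟨ kleisli ⟩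
    ext₁ δB (Jₖ ι̂) · ρ μΣ · ext₁ δΣ (j μΣ _ ∘ ⟨ η μΣ , γ ⟩)   ≈⟨ ·-resp-≈ˡ (ext₁-Jₖ δB) ⟩
    Jₖ (B.F₁ ι̂) · ρ μΣ · ext₁ δΣ (j μΣ _ ∘ ⟨ η μΣ , γ ⟩)      ≈⟨ Jₖ-· ⟩
    F₁ (B.F₁ ι̂) ∘ ρ μΣ · ext₁ δΣ (j μΣ _ ∘ ⟨ η μΣ , γ ⟩)      ≈⟨ refl⟩∘⟨ ρ·Σ̄j⟨η,g⟩≈ρ̄∘Σ⟨id,g⟩ γ ⟩
    F₁ (B.F₁ ι̂) ∘ ρ̄ L μΣ ∘ S.F₁ ⟨ id , γ ⟩                    ∎

  opModel-unique : ∀ {γ γ′} → IsOpModel L γ → IsOpModel L γ′ → γ ≈ γ′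
  opModel-unique model model′ = para-unique (trans model (sym assoc)) (trans model′ (sym assoc))

proposition22 : ∀ {o ℓ e p i : Level}
    (C : Category o ℓ e) (FL : FiniteLimits C) (FC : FiniteCoproducts C)
    (Sg B : Endofunctor C) (M : Monad {C = C})
    (initΣ : InitialAlgebra Sg) (freeΣ : FreeAlgebras Sg)
    (PI : Setting.ProductIso C FL FC M)
    (δΣ : DistributiveLaw M Sg) (δB : DistributiveLaw M B)
    (initB : InitialAlgebra B)
    (dcpo : Setting.KleisliDCPO C FL FC M p i B δB)
    (L : DeSimone.PreDeSimoneLaw C FL FC M Sg B initΣ freeΣ PI δΣ δB) →
    let open DeSimone C FL FC M Sg B initΣ freeΣ PI δΣ δB
        open Category C
    in ρ̄-IsNatural L
       × (∀ (γ : Hom μΣ (Monad.F₀ M (Endofunctor.F₀ B μΣ))) → IsKleisliOpModel L γ →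
            IsOpModel L γ
            × (∀ (γ' : Hom μΣ (Monad.F₀ M (Endofunctor.F₀ B μΣ))) → IsOpModel L γ' → γ' ≈ γ))
-- The initial B-algebra and the DCPO enrichment only serve to construct γ, which is given here.
proposition22 C FL FC Sg B M initΣ freeΣ PI δΣ δB _ _ L =
  ρ̄-natural , λ γ kleisli →
    let model = kleisliOpModel⇒opModel kleisli
    in model , λ γ′ model′ → opModel-unique model′ model
  where open PreDeSimoneLaws C FL FC M Sg B initΣ freeΣ PI δΣ δB L
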